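{- For all $m_1,m_2\in\mathbb{N}$ and every integer $i\ge 2$, \[ (m_1+m_2)^{(i)}\ge m_1^{(i)}+\min\left(m_2^{(i-1)},m_1\right). \]
   Context: $\mathbb{N}=\{1,2,3,\dots\}$. For $m,j\in\mathbb{N}$ there is a unique representation $m=\binom{n_j}{j}+\binom{n_{j-1}}{j-1}+\cdots+\binom{n_t}{t}$ with $n_j>n_{j-1}>\cdots>n_t\ge t\ge 1$, and the upper $j$-boundary is $m^{(j)}=\binom{n_j}{j+1}+\binom{n_{j-1}}{j}+\cdots+\binom{n_t}{t+1}$. -}

module Defs where

open import Data.Nat using (ℕ; suc; _+_; _≤_; _<_)
open import Data.Nat.Combinatorics using (_C_)
open import Data.Product using (∃-syntax)

-- RepFrom j B m b : m = C(n_j, j) + C(n_{j-1}, j-1) + ... + C(n_t, t)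
-- with B > n_j > n_{j-1} > ... > n_t ≥ t ≥ 1, and
-- b = C(n_j, j+1) + C(n_{j-1}, j) + ... + C(n_t, t+1)  (the upper boundary sum).
data RepFrom : (j B m b : ℕ) → Set where
  last : ∀ {j B n} → n < B → j ≤ n → 1 ≤ j →
         RepFrom j B (n C j) (n C suc j)
  step : ∀ {j B n m b} → n < B → RepFrom j n m b →
         RepFrom (suc j) B (n C suc j + m) (n C suc (suc j) + b)

-- UpperBoundary j m b : b = m^(j), i.e. b is computed from a j-binomial
-- representation of m (which exists and is unique for m, j ≥ 1).
UpperBoundary : (j m b : ℕ) → Set
UpperBoundary j m b = ∃[ B ] RepFrom j B m b

module Submission where

-- The upper j-boundary m^(j) and the Kruskal–Katona shadow m_(k) both arise by re-reading
-- the binomial representation m = C(n_j, j) + C(n_{j-1}, j-1) + ... with shifted lower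
-- indices.
-- They are linked by complementation (`duality`): if y + x = C(n, j+1) then
-- y^(j+1) + x_(n-j-1) = C(n, j+2).  Through it, subadditivity of the shadow becomes an
-- exchange inequality for the upper boundary and superadditivity of the upper boundary
-- one for the shadow (`upper-spread`, `shadow-spread`).
-- The theorem a^(i+2) + min(b^(i+1), a) ≤ (a+b)^(i+2) is proved together with three
-- companions (superadditivity of ^(j), its shadow analogue
-- (a+b)_(k+1) ≤ max(a_(k+1), b) + b_(k), and subadditivity of _(k)) by strong induction
-- on a + b (`invariants`): splitting off the leading term C(n, ·) of a and comparing b
-- with C(n, ·) reduces each to the four statements at smaller sums.

open import Defs
open import Data.Nat.Base
open import Data.Nat.Properties
open import Data.Nat.Combinatorics using (_C_; nCk+nC[k+1]≡[n+1]C[k+1]; k>n⇒nCk≡0; nCk≡nC[n∸k])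
open import Data.Product using (_,_; _×_; proj₂)
open import Data.Sum using (inj₁; inj₂)
open import Data.Empty using (⊥-elim)
open import Relation.Nullary using (¬_; yes; no)
open import Relation.Binary.PropositionalEquality
open import Data.Nat.Tactic.RingSolver using (solve-∀)

step-mono : (g : ℕ → ℕ) → (∀ m → g m ≤ g (suc m)) → ∀ {x y} → x ≤ y → g x ≤ g y
step-mono g grows {y = zero} z≤n = ≤-refl
step-mono g grows {y = suc y} x≤y with m≤n⇒m<n∨m≡n x≤y
... | inj₁ (s≤s x≤y') = ≤-trans (step-mono g grows x≤y') (grows y)
... | inj₂ refl = ≤-refl

m+n≤n⇒m≡0 : ∀ m n → m + n ≤ n → m ≡ 0
m+n≤n⇒m≡0 m n le = n≤0⇒n≡0 (+-cancelʳ-≤ n m 0 le)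

-- Binomial coefficients by Pascal's rule.  All recursions below unfold
-- binom (suc n) (suc k) definitionally; `C≡binom` identifies it with the library's n C k.
binom : ℕ → ℕ → ℕ
binom n zero = 1
binom zero (suc k) = 0
binom (suc n) (suc k) = binom n k + binom n (suc k)

C≡binom : ∀ n k → n C k ≡ binom n k
C≡binom n zero = refl
C≡binom zero (suc k) = k>n⇒nCk≡0 {0} {suc k} z<s
C≡binom (suc n) (suc k) =
  trans (sym (nCk+nC[k+1]≡[n+1]C[k+1] n k)) (cong₂ _+_ (C≡binom n k) (C≡binom n (suc k)))

binom-vanish : ∀ {n k} → n < k → binom n k ≡ 0
binom-vanish {zero} {suc k} _ = refl
binom-vanish {suc n} {suc k} (s≤s n<k) = cong₂ _+_ (binom-vanish n<k) (binom-vanish (m<n⇒m<1+n n<k))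

binom-diag : ∀ n → binom n n ≡ 1
binom-diag zero = refl
binom-diag (suc n) = cong₂ _+_ (binom-diag n) (binom-vanish (n<1+n n))

binom-one : ∀ n → binom n 1 ≡ n
binom-one zero = refl
binom-one (suc n) = cong suc (binom-one n)

binom-two-suc : ∀ a → binom (suc a) 2 ≡ a + binom a 2
binom-two-suc a = cong (_+ binom a 2) (binom-one a)

-- C(a+b, 2) = C(a, 2) + C(b, 2) + ab: the upper boundary at level 1 is superadditive.
binom-two-add : ∀ a b → binom (a + b) 2 ≡ binom a 2 + binom b 2 + a * b
binom-two-add a zero rewrite +-identityʳ a | *-zeroʳ a = sym (trans (+-identityʳ _) (+-identityʳ _))
binom-two-add a (suc b)
  rewrite +-suc a b | binom-two-suc (a + b) | binom-two-add a b | binom-two-suc b = regroup a b (binom a 2) (binom b 2)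
  where
  regroup : ∀ a b x y → a + b + (x + y + a * b) ≡ x + (b + y) + a * suc b
  regroup = solve-∀

binom-step : ∀ n k → binom n k ≤ binom (suc n) k
binom-step n zero = ≤-refl
binom-step n (suc k) = m≤n+m (binom n (suc k)) (binom n k)

binom-mono : ∀ k {n n'} → n ≤ n' → binom n k ≤ binom n' k
binom-mono k = step-mono (λ n → binom n k) (λ n → binom-step n k)

binom-pos : ∀ {n k} → k ≤ n → 1 ≤ binom n k
binom-pos {n} {zero} _ = ≤-refl
binom-pos {suc n} {suc k} (s≤s k≤n) = ≤-trans (binom-pos k≤n) (m≤m+n (binom n k) _)

binom-at-most-one : ∀ {n k} → n ≤ k → binom n k ≤ 1
binom-at-most-one {n} {k} n≤k with m≤n⇒m<n∨m≡n n≤k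
... | inj₁ n<k = ≤-trans (≤-reflexive (binom-vanish n<k)) z≤n
... | inj₂ refl = ≤-reflexive (binom-diag k)

-- C(m+k, k) > m for k ≥ 1: enough room to read off m at level k.
binom-large : ∀ m k → 1 ≤ k → m < binom (m + k) k
binom-large m (suc zero) _ rewrite +-comm m 1 | binom-one m = ≤-refl
binom-large m (suc (suc k)) _ =
  subst (λ t → suc m ≤ binom t (suc (suc k))) (sym (+-suc m (suc k)))
    (≤-trans (binom-large m (suc k) (s≤s z≤n)) (m≤m+n _ _))

binom-sym : ∀ {n k} → k ≤ n → binom n k ≡ binom n (n ∸ k)
binom-sym {n} {k} k≤n = trans (sym (C≡binom n k)) (trans (nCk≡nC[n∸k] k≤n) (C≡binom n (n ∸ k)))

binom-sub-diag : ∀ k → binom (suc k) k ≡ suc k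
binom-sub-diag k = trans (binom-sym (n≤1+n k)) (trans (cong (binom (suc k)) (m+n∸n≡m 1 k)) (binom-one (suc k)))

-- The leading term of the (k+1)-binomial representation of m ≥ 1:
-- m = C(n, k+1) + r with k+1 ≤ n and r < C(n, k).
record Decomposition (k m : ℕ) : Set where
  constructor decomposition
  field
    n r : ℕ
    k<n : suc k ≤ n
    m≡ : m ≡ binom n (suc k) + r
    r< : r < binom n k

decompose : ∀ k m → 1 ≤ m → Decomposition k m
decompose k m 1≤m = search (m + suc k) (binom-large m (suc k) (s≤s z≤n))
  where
  -- find the largest N with C(N, k+1) ≤ m below a bound where m < C(N, k+1)
  search : ∀ N → m < binom N (suc k) → Decomposition k m
  search zero m<0 = ⊥-elim (n≮0 m<0)
  search (suc N) m< with m <? binom N (suc k)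
  ... | yes m<' = search N m<'
  ... | no m≮ with suc k ≤? N
  ...   | yes k<N = decomposition N (m ∸ binom N (suc k)) k<N (sym (m+[n∸m]≡n ge))
            (+-cancelˡ-< (binom N (suc k)) _ _
              (subst₂ _<_ (sym (m+[n∸m]≡n ge)) (+-comm (binom N k) _) m<))
    where ge = ≮⇒≥ m≮
  ...   | no k≮N = ⊥-elim (<⇒≱ (≤-trans m< (binom-at-most-one (≰⇒> k≮N))) 1≤m)

-- At level L ≥ 2 the number m is
-- split as C(n, L) + r with n as large as allowed, `term n L` is emitted and r is
-- read at level L-1; at level 1 the remaining number is mapped by `base`.
module Greedy
  (base : ℕ → ℕ) (term : ℕ → ℕ → ℕ)
  (base-zero : base 0 ≡ 0)
  (base-grows : ∀ m → base m ≤ base (suc m))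
  (base-full : ∀ n → 1 ≤ n → base (binom n 1) ≡ term n 1)
  (term-pascal : ∀ n k → term (suc n) (suc (suc k)) ≡ term n (suc k) + term n (suc (suc k)))
  where

  -- run L N m reads m at level L using only the coefficients C(n, L) with n < N.
  run : ℕ → ℕ → ℕ → ℕ
  run zero N m = 0
  run (suc zero) N m = base m
  run (suc (suc k)) zero m = 0
  run (suc (suc k)) (suc n) m with m ≤? binom n (suc (suc k))
  ... | yes _ = run (suc (suc k)) n m
  ... | no _ = term n (suc (suc k)) + run (suc k) n (m ∸ binom n (suc (suc k)))

  run-skip : ∀ L n m → m ≤ binom n L → run L (suc n) m ≡ run L n m
  run-skip zero n m _ = refl
  run-skip (suc zero) n m _ = refl
  run-skip (suc (suc k)) n m m≤ with m ≤? binom n (suc (suc k))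
  ... | yes _ = refl
  ... | no m≰ = ⊥-elim (m≰ m≤)

  run-take : ∀ k n m → ¬ m ≤ binom n (suc (suc k)) →
    run (suc (suc k)) (suc n) m ≡ term n (suc (suc k)) + run (suc k) n (m ∸ binom n (suc (suc k)))
  run-take k n m m≰ with m ≤? binom n (suc (suc k))
  ... | yes m≤ = ⊥-elim (m≰ m≤)
  ... | no _ = refl

  run-fuel : ∀ L {n n'} m → m ≤ binom n L → n ≤ n' → run L n' m ≡ run L n m
  run-fuel L {n} {n'} m m≤ n≤n' with m≤n⇒m<n∨m≡n n≤n'
  ... | inj₂ refl = refl
  ... | inj₁ (s≤s {n = n''} n≤n'') =
    trans (run-skip L n'' m (≤-trans m≤ (binom-mono L n≤n''))) (run-fuel L m m≤ n≤n'')

  value : ℕ → ℕ → ℕ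
  value L m = run L (m + L) m

  value-fuel : ∀ L n m → m ≤ binom n L → value L m ≡ run L n m
  value-fuel zero n m _ = refl
  value-fuel (suc L) n m m≤ with ≤-total n (m + suc L)
  ... | inj₁ n≤ = run-fuel (suc L) m m≤ n≤
  ... | inj₂ ≤n = sym (run-fuel (suc L) m (<⇒≤ (binom-large m (suc L) (s≤s z≤n))) ≤n)

  run-zero : ∀ L N → run L N 0 ≡ 0
  run-zero zero N = refl
  run-zero (suc zero) N = base-zero
  run-zero (suc (suc k)) zero = refl
  run-zero (suc (suc k)) (suc n) = trans (run-skip (suc (suc k)) n 0 z≤n) (run-zero (suc (suc k)) n)

  value-zero : ∀ L → value L 0 ≡ 0
  value-zero L = run-zero L L

  run-full : ∀ L n → 1 ≤ L → L ≤ n → run L n (binom n L) ≡ term n L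
  run-full (suc zero) n _ 1≤n = base-full n 1≤n
  run-full (suc (suc k)) (suc n) _ (s≤s k<n) = begin
      run L (suc n) (binom n (suc k) + binom n L)
        ≡⟨ run-take k n _ (λ le → <⇒≢ (binom-pos k<n) (sym (m+n≤n⇒m≡0 _ _ le))) ⟩
      term n L + run (suc k) n (binom n (suc k) + binom n L ∸ binom n L)
        ≡⟨ cong (λ t → term n L + run (suc k) n t) (m+n∸n≡m (binom n (suc k)) (binom n L)) ⟩
      term n L + run (suc k) n (binom n (suc k))
        ≡⟨ cong (term n L +_) (run-full (suc k) n (s≤s z≤n) k<n) ⟩
      term n L + term n (suc k)
        ≡⟨ +-comm (term n L) _ ⟩
      term n (suc k) + term n L
        ≡⟨ sym (term-pascal n k) ⟩
      term (suc n) L ∎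
    where
    open ≡-Reasoning
    L = suc (suc k)

  value-full : ∀ L n → 1 ≤ L → L ≤ n → value L (binom n L) ≡ term n L
  value-full L n 1≤L L≤n = trans (value-fuel L n _ ≤-refl) (run-full L n 1≤L L≤n)

  value-rec : ∀ k n r → suc (suc k) ≤ n → r ≤ binom n (suc k) →
    value (suc (suc k)) (binom n (suc (suc k)) + r) ≡ term n (suc (suc k)) + value (suc k) r
  value-rec k n zero L≤n _ = begin
      value L (binom n L + 0)   ≡⟨ cong (value L) (+-identityʳ (binom n L)) ⟩
      value L (binom n L)       ≡⟨ value-full L n (s≤s z≤n) L≤n ⟩
      term n L                  ≡⟨ sym (+-identityʳ _) ⟩
      term n L + 0              ≡⟨ cong (term n L +_) (sym (value-zero (suc k))) ⟩
      term n L + value (suc k) 0 ∎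
    where
    open ≡-Reasoning
    L = suc (suc k)
  value-rec k n (suc r) L≤n r≤ = begin
      value L (binom n L + suc r)
        ≡⟨ value-fuel L (suc n) _ (subst (binom n L + suc r ≤_) (+-comm (binom n L) _) (+-monoʳ-≤ _ r≤)) ⟩
      run L (suc n) (binom n L + suc r)
        ≡⟨ run-take k n _ (λ le → 0≢1+n (sym (m+n≤n⇒m≡0 _ _ (subst (_≤ binom n L) (+-comm (binom n L) _) le)))) ⟩
      term n L + run (suc k) n (binom n L + suc r ∸ binom n L)
        ≡⟨ cong (λ t → term n L + run (suc k) n t) (m+n∸m≡n (binom n L) (suc r)) ⟩
      term n L + run (suc k) n (suc r)
        ≡⟨ cong (term n L +_) (sym (value-fuel (suc k) n (suc r) r≤)) ⟩
      term n L + value (suc k) (suc r) ∎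
    where
    open ≡-Reasoning
    L = suc (suc k)

  grows-up : ∀ k → (∀ r → value (suc k) r ≤ value (suc k) (suc r)) →
    ∀ m → value (suc (suc k)) m ≤ value (suc (suc k)) (suc m)
  grows-up k _ zero = subst (_≤ value (suc (suc k)) 1) (sym (value-zero (suc (suc k)))) z≤n
  grows-up k grows (suc m) with decompose (suc k) (suc m) (s≤s z≤n)
  ... | decomposition n r L≤n m≡ r< = begin
      value L (suc m)                       ≡⟨ cong (value L) m≡ ⟩
      value L (binom n L + r)               ≡⟨ value-rec k n r L≤n (<⇒≤ r<) ⟩
      term n L + value (suc k) r            ≤⟨ +-monoʳ-≤ (term n L) (grows r) ⟩
      term n L + value (suc k) (suc r)      ≡⟨ sym (value-rec k n (suc r) L≤n r<) ⟩
      value L (binom n L + suc r)           ≡⟨ cong (value L) (sym (trans (cong suc m≡) (sym (+-suc _ r)))) ⟩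
      value L (suc (suc m)) ∎
    where
    open ≤-Reasoning
    L = suc (suc k)

  value-grows : ∀ L m → value L m ≤ value L (suc m)
  value-grows zero m = z≤n
  value-grows (suc zero) m = base-grows m
  value-grows (suc (suc k)) = grows-up k (value-grows (suc k))

  value-mono : ∀ L {x y} → x ≤ y → value L x ≤ value L y
  value-mono L = step-mono (value L) (value-grows L)

-- The upper boundary m^(j): each C(n_i, i) of the representation becomes C(n_i, i+1).
module Upper = Greedy (λ m → binom m 2) (λ n L → binom n (suc L))
  refl (λ m → binom-step m 2) (λ n _ → cong (λ t → binom t 2) (binom-one n)) (λ n k → refl)

upper : ℕ → ℕ → ℕ
upper = Upper.value

upper-zero : ∀ j → upper j 0 ≡ 0
upper-zero = Upper.value-zero

upper-mono : ∀ j {x y} → x ≤ y → upper j x ≤ upper j y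
upper-mono = Upper.value-mono

upper-rec : ∀ j n r → suc (suc j) ≤ n → r ≤ binom n (suc j) →
  upper (suc (suc j)) (binom n (suc (suc j)) + r) ≡ binom n (suc (suc (suc j))) + upper (suc j) r
upper-rec = Upper.value-rec

-- C(n, j)^(j) = C(n, j+1), also when n < j and both sides vanish.
upper-full : ∀ j n → upper (suc j) (binom n (suc j)) ≡ binom n (suc (suc j))
upper-full j n with suc j ≤? n
... | yes j<n = Upper.value-full (suc j) n (s≤s z≤n) j<n
... | no j≮n = begin
    upper (suc j) (binom n (suc j)) ≡⟨ cong (upper (suc j)) (binom-vanish n<j+1) ⟩
    upper (suc j) 0                 ≡⟨ upper-zero (suc j) ⟩
    0                               ≡⟨ sym (binom-vanish (m<n⇒m<1+n n<j+1)) ⟩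
    binom n (suc (suc j)) ∎
  where
  open ≡-Reasoning
  n<j+1 = ≰⇒> j≮n

-- The lower shadow m_(k) (Kruskal–Katona): C(n_i, i) becomes C(n_i, i-1).
module Shadow = Greedy (1 ⊓_) (λ n L → binom n (pred L))
  refl (λ m → ⊓-monoʳ-≤ 1 (n≤1+n m))
  (λ n 1≤n → m≤n⇒m⊓n≡m (subst (1 ≤_) (sym (binom-one n)) 1≤n)) (λ n k → refl)

shadow : ℕ → ℕ → ℕ
shadow = Shadow.value

shadow-zero : ∀ k → shadow k 0 ≡ 0
shadow-zero = Shadow.value-zero

shadow-mono : ∀ k {x y} → x ≤ y → shadow k x ≤ shadow k y
shadow-mono = Shadow.value-mono

shadow-grows : ∀ k m → shadow k m ≤ shadow k (suc m)
shadow-grows = Shadow.value-grows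

shadow-level-one : ∀ m → 1 ≤ m → shadow 1 m ≡ 1
shadow-level-one m 1≤m = m≤n⇒m⊓n≡m 1≤m

shadow-rec : ∀ k n r → suc k ≤ n → r ≤ binom n k →
  shadow (suc k) (binom n (suc k) + r) ≡ binom n k + shadow k r
shadow-rec zero n r 1≤n _ =
  shadow-level-one (binom n 1 + r) (≤-trans (subst (1 ≤_) (sym (binom-one n)) 1≤n) (m≤m+n _ r))
shadow-rec (suc k) = Shadow.value-rec k

shadow-full : ∀ k n → suc k ≤ n → shadow (suc k) (binom n (suc k)) ≡ binom n k
shadow-full k n = Shadow.value-full (suc k) n (s≤s z≤n)

shadow-one : ∀ k → shadow (suc k) 1 ≡ suc k
shadow-one k = begin
    shadow (suc k) 1                         ≡⟨ cong (shadow (suc k)) (sym (binom-diag (suc k))) ⟩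
    shadow (suc k) (binom (suc k) (suc k))   ≡⟨ shadow-full k (suc k) ≤-refl ⟩
    binom (suc k) k                          ≡⟨ binom-sub-diag k ⟩
    suc k ∎
  where open ≡-Reasoning

complement-split : ∀ {y x} a b → y + x ≡ a + b → x ≤ b → y ≡ a + (b ∸ x)
complement-split {y} {x} a b sum x≤b = +-cancelʳ-≡ x y (a + (b ∸ x)) (begin
    y + x             ≡⟨ sum ⟩
    a + b             ≡⟨ cong (a +_) (sym (m∸n+n≡m x≤b)) ⟩
    a + (b ∸ x + x)   ≡⟨ sym (+-assoc a (b ∸ x) x) ⟩
    a + (b ∸ x) + x ∎)
  where open ≡-Reasoning

Duality : ℕ → ℕ → Set
Duality n j = ∀ y x → y + x ≡ binom n (suc j) →
  upper (suc j) y + shadow (n ∸ suc j) x ≡ binom n (suc (suc j))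

-- j = n: C(n+1, n+1) = 1, the shadow level is 0 and everything vanishes.
duality-top : ∀ n → Duality (suc n) n
duality-top n y x sum rewrite n∸n≡0 n | binom-vanish {suc n} {suc (suc n)} (n<1+n _) =
  trans (+-identityʳ _) (n≤0⇒n≡0 (begin
    upper (suc n) y                           ≤⟨ upper-mono (suc n) (subst (y ≤_) sum (m≤m+n y x)) ⟩
    upper (suc n) (binom (suc n) (suc n))     ≡⟨ upper-full n (suc n) ⟩
    binom (suc n) (suc (suc n))               ≡⟨ binom-vanish (n<1+n (suc n)) ⟩
    0 ∎))
  where open ≤-Reasoning

duality-bottom : ∀ n → 1 ≤ n → ∀ y x → x ≤ 1 → y + x ≡ binom (suc n) 1 →
  upper 1 y + shadow n x ≡ binom (suc n) 2
duality-bottom (suc k) _ y x x≤1 sum with n≤1⇒n≡0∨n≡1 x≤1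
... | inj₁ refl = begin
    binom y 2 + shadow (suc k) 0    ≡⟨ cong₂ _+_ (cong (λ t → binom t 2) y≡) (shadow-zero (suc k)) ⟩
    binom (suc (suc k)) 2 + 0       ≡⟨ +-identityʳ _ ⟩
    binom (suc (suc k)) 2 ∎
  where
  open ≡-Reasoning
  y≡ : y ≡ suc (suc k)
  y≡ = trans (sym (+-identityʳ y)) (trans sum (binom-one (suc (suc k))))
... | inj₂ refl = begin
    binom y 2 + shadow (suc k) 1    ≡⟨ cong₂ _+_ (cong (λ t → binom t 2) y≡) (shadow-one k) ⟩
    binom (suc k) 2 + suc k         ≡⟨ +-comm (binom (suc k) 2) _ ⟩
    suc k + binom (suc k) 2         ≡⟨ sym (binom-two-suc (suc k)) ⟩
    binom (suc (suc k)) 2 ∎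
  where
  open ≡-Reasoning
  y≡ : y ≡ suc k
  y≡ = +-cancelʳ-≡ 1 y (suc k) (trans sum (trans (binom-one (suc (suc k))) (+-comm 1 (suc k))))

-- x ≤ C(n, j): then y ≥ C(n, j+1) and the leading term C(n, j+1) of y is split off.
duality-keep : ∀ n j → j < n → (∀ j' → suc j' ≤ n → Duality n j') →
  ∀ y x → x ≤ binom n j → y + x ≡ binom (suc n) (suc j) →
  upper (suc j) y + shadow (n ∸ j) x ≡ binom (suc n) (suc (suc j))
duality-keep n zero j<n _ y x x≤ sum = duality-bottom n j<n y x x≤ sum
duality-keep n (suc j) j<n duality-n y x x≤ sum = begin
    upper L y + shadow (n ∸ suc j) x
      ≡⟨ cong (λ t → upper L t + shadow (n ∸ suc j) x) y≡ ⟩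
    upper L (binom n L + y') + shadow (n ∸ suc j) x
      ≡⟨ cong (_+ shadow (n ∸ suc j) x) (upper-rec j n y' j<n (m∸n≤m _ x)) ⟩
    binom n (suc L) + upper (suc j) y' + shadow (n ∸ suc j) x
      ≡⟨ +-assoc (binom n (suc L)) _ _ ⟩
    binom n (suc L) + (upper (suc j) y' + shadow (n ∸ suc j) x)
      ≡⟨ cong (binom n (suc L) +_) (duality-n j (<⇒≤ j<n) y' x (m∸n+n≡m x≤)) ⟩
    binom n (suc L) + binom n L
      ≡⟨ +-comm (binom n (suc L)) _ ⟩
    binom (suc n) (suc L) ∎
  where
  open ≡-Reasoning
  L = suc (suc j)
  y' = binom n (suc j) ∸ x
  y≡ : y ≡ binom n L + y'
  y≡ = complement-split (binom n L) (binom n (suc j)) (trans sum (+-comm (binom n (suc j)) _)) x≤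

-- x > C(n, j): x = C(n, j) + x'', and C(n, j) = C(n, n-j) is the leading term of x
-- at the shadow level n-j.
duality-spill : ∀ n j → j < n → Duality n j →
  ∀ y x → ¬ x ≤ binom n j → y + x ≡ binom (suc n) (suc j) →
  upper (suc j) y + shadow (n ∸ j) x ≡ binom (suc n) (suc (suc j))
duality-spill n j j<n duality-n y x x≰ sum = begin
    upper (suc j) y + shadow (n ∸ j) x
      ≡⟨ cong₂ (λ l t → upper (suc j) y + shadow l t) level x≡ ⟩
    upper (suc j) y + shadow (suc k) (binom n (suc k) + x'')
      ≡⟨ cong (upper (suc j) y +_) (shadow-rec k n x'' k<n x''≤) ⟩
    upper (suc j) y + (binom n k + shadow k x'')
      ≡⟨ +-comm (upper (suc j) y) _ ⟩
    binom n k + shadow k x'' + upper (suc j) y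
      ≡⟨ +-assoc (binom n k) _ _ ⟩
    binom n k + (shadow k x'' + upper (suc j) y)
      ≡⟨ cong₂ _+_ (sym (binom-sym j<n)) (trans (+-comm _ (upper (suc j) y)) (duality-n y x'' sum'')) ⟩
    binom (suc n) (suc (suc j)) ∎
  where
  open ≡-Reasoning
  k = n ∸ suc j
  x'' = x ∸ binom n j
  level : n ∸ j ≡ suc k
  level = +-∸-assoc 1 j<n
  x≡ : x ≡ binom n (suc k) + x''
  x≡ = trans (sym (m+[n∸m]≡n (<⇒≤ (≰⇒> x≰))))
             (cong (_+ x'') (trans (binom-sym (<⇒≤ j<n)) (cong (binom n) level)))
  sum'' : y + x'' ≡ binom n (suc j)
  sum'' = +-cancelˡ-≡ (binom n j) _ _ (begin
    binom n j + (y + x'')   ≡⟨ +-comm (binom n j) _ ⟩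
    y + x'' + binom n j     ≡⟨ +-assoc y x'' _ ⟩
    y + (x'' + binom n j)   ≡⟨ cong (y +_) (m∸n+n≡m (<⇒≤ (≰⇒> x≰))) ⟩
    y + x                   ≡⟨ sum ⟩
    binom n j + binom n (suc j) ∎)
  x''≤ : x'' ≤ binom n k
  x''≤ = subst (x'' ≤_) (trans sum'' (binom-sym j<n)) (m≤n+m x'' y)
  k<n : suc k ≤ n
  k<n = subst (_≤ n) level (m∸n≤m n j)

duality : ∀ n j → suc j ≤ n → Duality n j
duality (suc n) j (s≤s j≤n) y x sum with m≤n⇒m<n∨m≡n j≤n
... | inj₂ refl = duality-top n y x sum
... | inj₁ j<n with x ≤? binom n j
...   | yes x≤ = duality-keep n j j<n (duality n) y x x≤ sum
...   | no x≰ = duality-spill n j j<n (duality n j j<n) y x x≰ sum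

complements-sum : ∀ {N x y e} → x ≤ N → y ≤ N → N + e ≡ x + y → e + ((N ∸ x) + (N ∸ y)) ≡ N
complements-sum {N} {x} {y} {e} x≤N y≤N sum = +-cancelˡ-≡ N _ _ (begin
    N + (e + ((N ∸ x) + (N ∸ y)))   ≡⟨ regroup N e (N ∸ x) (N ∸ y) ⟩
    (N + e) + (N ∸ x) + (N ∸ y)     ≡⟨ cong (λ t → t + (N ∸ x) + (N ∸ y)) sum ⟩
    (x + y) + (N ∸ x) + (N ∸ y)     ≡⟨ swap x y (N ∸ x) (N ∸ y) ⟩
    (x + (N ∸ x)) + (y + (N ∸ y))   ≡⟨ cong₂ _+_ (m+[n∸m]≡n x≤N) (m+[n∸m]≡n y≤N) ⟩
    N + N ∎)
  where
  open ≡-Reasoning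
  regroup : ∀ N e u v → N + (e + (u + v)) ≡ (N + e) + u + v
  regroup = solve-∀
  swap : ∀ x y u v → (x + y) + u + v ≡ (x + u) + (y + v)
  swap = solve-∀

complements-bound : ∀ {N x y e} → x ≤ N → y ≤ N → N + e ≡ x + y → (N ∸ x) + (N ∸ y) ≤ N
complements-bound {N} {x} {y} {e} x≤N y≤N sum =
  subst ((N ∸ x) + (N ∸ y) ≤_) (complements-sum x≤N y≤N sum) (m≤n+m _ e)

-- If A z + B w = T whenever z + w = N (and B 0 = 0), then moving
-- x, y ≤ N apart to N, e (N + e = x + y) changes the A-sum exactly as merging the
-- complements changes the B-sum.  So subadditivity of B gives "A x + A y ≤ A N + A e",
-- and superadditivity of B gives the reverse.
exchange : (A B : ℕ → ℕ) (N T : ℕ) → B 0 ≡ 0 → (∀ z w → z + w ≡ N → A z + B w ≡ T) →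
  ∀ {x y e} → x ≤ N → y ≤ N → N + e ≡ x + y →
  (A x + A y) + (B (N ∸ x) + B (N ∸ y)) ≡ (A N + A e) + B ((N ∸ x) + (N ∸ y))
exchange A B N T B0 pair {x} {y} {e} x≤N y≤N sum = begin
    (A x + A y) + (B x̄ + B ȳ)         ≡⟨ swap (A x) (A y) (B x̄) (B ȳ) ⟩
    (A x + B x̄) + (A y + B ȳ)         ≡⟨ cong₂ _+_ (pair x x̄ (m+[n∸m]≡n x≤N)) (pair y ȳ (m+[n∸m]≡n y≤N)) ⟩
    T + T                             ≡⟨ sym (cong₂ _+_ (pair N 0 (+-identityʳ N))
                                                          (pair e (x̄ + ȳ) (complements-sum x≤N y≤N sum))) ⟩
    (A N + B 0) + (A e + B (x̄ + ȳ))   ≡⟨ cong (λ t → (A N + t) + (A e + B (x̄ + ȳ))) B0 ⟩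
    (A N + 0) + (A e + B (x̄ + ȳ))     ≡⟨ regroup (A N) (A e) (B (x̄ + ȳ)) ⟩
    (A N + A e) + B (x̄ + ȳ) ∎
  where
  open ≡-Reasoning
  x̄ = N ∸ x
  ȳ = N ∸ y
  swap : ∀ a b c d → (a + b) + (c + d) ≡ (a + c) + (b + d)
  swap = solve-∀
  regroup : ∀ a b c → (a + 0) + (b + c) ≡ (a + b) + c
  regroup = solve-∀

MainIneq : ℕ → ℕ → ℕ → Set
MainIneq i a b = upper (suc (suc i)) a + (upper (suc i) b ⊓ a) ≤ upper (suc (suc i)) (a + b)

UpperSuperadditive : ℕ → ℕ → ℕ → Set
UpperSuperadditive j x y = upper (suc j) x + upper (suc j) y ≤ upper (suc j) (x + y)

ShadowMaxIneq : ℕ → ℕ → ℕ → Set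
ShadowMaxIneq k a b = shadow (suc k) (a + b) ≤ (shadow (suc k) a ⊔ b) + shadow k b

ShadowSubadditive : ℕ → ℕ → ℕ → Set
ShadowSubadditive k x y = shadow k (x + y) ≤ shadow k x + shadow k y

-- Subadditivity of the shadow at the complementary level makes the upper boundary
-- prefer extreme splits: for x, y ≤ N = C(n, j+1) with N + e = x + y,
-- x^(j+1) + y^(j+1) ≤ N^(j+1) + e^(j+1).
upper-spread : ∀ j n → suc j ≤ n → let N = binom n (suc j) ; k = n ∸ suc j in
  (∀ u v → u + v ≤ N → ShadowSubadditive k u v) →
  ∀ {x y e} → x ≤ N → y ≤ N → N + e ≡ x + y →
  upper (suc j) x + upper (suc j) y ≤ upper (suc j) N + upper (suc j) e
upper-spread j n j<n subadd {x} {y} {e} x≤N y≤N sum =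
  +-cancelʳ-≤ (G x̄ + G ȳ) _ _ (begin
    (F x + F y) + (G x̄ + G ȳ)   ≡⟨ exchange F G N _ (shadow-zero k) (duality n j j<n) x≤N y≤N sum ⟩
    (F N + F e) + G (x̄ + ȳ)     ≤⟨ +-monoʳ-≤ (F N + F e) (subadd x̄ ȳ (complements-bound x≤N y≤N sum)) ⟩
    (F N + F e) + (G x̄ + G ȳ) ∎)
  where
  open ≤-Reasoning
  N = binom n (suc j)
  k = n ∸ suc j
  F = upper (suc j)
  G = shadow k
  x̄ = N ∸ x
  ȳ = N ∸ y

-- Dually, superadditivity of the upper boundary makes the shadow prefer balanced splits:
-- N_(k+1) + e_(k+1) ≤ x_(k+1) + y_(k+1) for N = C(n, k+1).
shadow-spread : ∀ k n → suc (suc k) ≤ n → let N = binom n (suc k) in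
  (∀ j u v → u + v ≤ N → UpperSuperadditive j u v) →
  ∀ {x y e} → x ≤ N → y ≤ N → N + e ≡ x + y →
  shadow (suc k) N + shadow (suc k) e ≤ shadow (suc k) x + shadow (suc k) y
shadow-spread k n k+2≤n superadd {x} {y} {e} x≤N y≤N sum =
  +-cancelʳ-≤ (F x̄ + F ȳ) _ _ (begin
    (G N + G e) + (F x̄ + F ȳ)   ≤⟨ +-monoʳ-≤ (G N + G e) (superadd j x̄ ȳ (complements-bound x≤N y≤N sum)) ⟩
    (G N + G e) + F (x̄ + ȳ)     ≡⟨ sym (exchange G F N _ (upper-zero (suc j)) pair x≤N y≤N sum) ⟩
    (G x + G y) + (F x̄ + F ȳ) ∎)
  where
  open ≤-Reasoning
  j = n ∸ suc (suc k)
  n≡ : suc (suc k) + j ≡ n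
  n≡ = m+[n∸m]≡n k+2≤n
  level : n ∸ suc j ≡ suc k
  level = trans (cong (_∸ suc j) (trans (sym n≡) (sym (+-suc (suc k) j)))) (m+n∸n≡m (suc k) (suc j))
  j<n : suc j ≤ n
  j<n = subst (suc j ≤_) n≡ (s≤s (≤-trans (m≤n+m j k) (n≤1+n _)))
  N = binom n (suc k)
  F = upper (suc j)
  G = shadow (suc k)
  x̄ = N ∸ x
  ȳ = N ∸ y
  pair : ∀ z w → z + w ≡ N → G z + F w ≡ binom n (suc (suc j))
  pair z w zw = trans (+-comm (G z) (F w))
    (subst (λ l → F w + shadow l z ≡ binom n (suc (suc j))) level
      (duality n j j<n w z (trans (+-comm w z) (trans zw (sym (trans (binom-sym j<n) (cong (binom n) level)))))))

record Invariants (s : ℕ) : Set where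
  field
    main : ∀ i a b → a + b ≤ s → MainIneq i a b
    upper-superadd : ∀ j x y → x + y ≤ s → UpperSuperadditive j x y
    shadow-max : ∀ k a b → a + b ≤ s → ShadowMaxIneq k a b
    shadow-subadd : ∀ k x y → x + y ≤ s → ShadowSubadditive k x y

module _ {k a : ℕ} (d : Decomposition k a) where
  open Decomposition d

  leading-sum : ∀ b → a + b ≡ binom n (suc k) + (r + b)
  leading-sum b = trans (cong (_+ b) m≡) (+-assoc (binom n (suc k)) r b)

  rest-bound : ∀ {b s} → a + b ≡ suc s → r + b ≤ s
  rest-bound {b} sum = ≤-pred (begin
      suc (r + b)                  ≤⟨ +-monoˡ-≤ (r + b) (binom-pos k<n) ⟩
      binom n (suc k) + (r + b)    ≡⟨ sym (leading-sum b) ⟩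
      a + b                        ≡⟨ sum ⟩
      suc _ ∎)
    where open ≤-Reasoning

leading-upper : ∀ {i a} (d : Decomposition (suc i) a) → let open Decomposition d in
  upper (suc (suc i)) a ≡ binom n (suc (suc (suc i))) + upper (suc i) r
leading-upper {i} d = trans (cong (upper (suc (suc i))) m≡) (upper-rec i n r k<n (<⇒≤ r<))
  where open Decomposition d

leading-shadow : ∀ {k a} (d : Decomposition (suc k) a) → let open Decomposition d in
  shadow (suc (suc k)) a ≡ binom n (suc k) + shadow (suc k) r
leading-shadow {k} d = trans (cong (shadow (suc (suc k))) m≡) (shadow-rec (suc k) n r k<n (<⇒≤ r<))
  where open Decomposition d

-- Throughout, a = C(n, i+2) + r with r < N = C(n, i+1), so a^(i+2) = C(n, i+3) + r^(i+1).
-- Case r + b ≤ N: a + b keeps the leading term; superadditivity on (r, b) suffices.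
main-fits : ∀ {s i a b} → Invariants s → (d : Decomposition (suc i) a) →
  let open Decomposition d in r + b ≤ s → r + b ≤ binom n (suc i) → MainIneq i a b
main-fits {s} {i} {a} {b} IH d r+b≤s fits = begin
    F a + (g b ⊓ a)        ≤⟨ +-monoʳ-≤ (F a) (m⊓n≤m (g b) a) ⟩
    F a + g b              ≡⟨ cong (_+ g b) (leading-upper d) ⟩
    B' + g r + g b         ≡⟨ +-assoc B' (g r) (g b) ⟩
    B' + (g r + g b)       ≤⟨ +-monoʳ-≤ B' (Invariants.upper-superadd IH i r b r+b≤s) ⟩
    B' + g (r + b)         ≡⟨ sym (upper-rec i n (r + b) k<n fits) ⟩
    F (B + (r + b))        ≡⟨ cong F (sym (leading-sum d b)) ⟩
    F (a + b) ∎
  where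
  open ≤-Reasoning
  open Decomposition d
  F = upper (suc (suc i))
  g = upper (suc i)
  B = binom n (suc (suc i))
  B' = binom n (suc (suc (suc i)))

-- Case b ≤ N < r + b: a + b = C(n+1, i+2) + e with N + e = r + b, and spreading
-- r, b apart to N, e raises the upper boundary (subadditivity of the shadow).
main-spread : ∀ {s i a b} → Invariants s → (d : Decomposition (suc i) a) →
  let open Decomposition d in r + b ≤ s → binom n (suc i) < r + b → b ≤ binom n (suc i) → MainIneq i a b
main-spread {s} {i} {a} {b} IH d r+b≤s N<r+b b≤N = begin
    F a + (g b ⊓ a)        ≤⟨ +-monoʳ-≤ (F a) (m⊓n≤m (g b) a) ⟩
    F a + g b              ≡⟨ cong (_+ g b) (leading-upper d) ⟩
    B' + g r + g b         ≡⟨ +-assoc B' (g r) (g b) ⟩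
    B' + (g r + g b)       ≤⟨ +-monoʳ-≤ B' (upper-spread i n i<n subadd (<⇒≤ r<) b≤N N+e) ⟩
    B' + (g N + g e)       ≡⟨ cong (λ t → B' + (t + g e)) (upper-full i n) ⟩
    B' + (B + g e)         ≡⟨ regroup B' B (g e) ⟩
    B + B' + g e           ≡⟨ sym (upper-rec i (suc n) e (≤-trans k<n (n≤1+n n)) e≤) ⟩
    F (binom (suc n) (suc (suc i)) + e)
                           ≡⟨ cong F (sym a+b≡) ⟩
    F (a + b) ∎
  where
  open ≤-Reasoning
  open Decomposition d
  F = upper (suc (suc i))
  g = upper (suc i)
  N = binom n (suc i)
  B = binom n (suc (suc i))
  B' = binom n (suc (suc (suc i)))
  i<n : suc i ≤ n
  i<n = ≤-pred (m≤n⇒m≤1+n k<n)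
  e = r + b ∸ N
  N+e : N + e ≡ r + b
  N+e = m+[n∸m]≡n (<⇒≤ N<r+b)
  e≤ : e ≤ binom (suc n) (suc i)
  e≤ = ≤-trans (≤-trans (∸-monoˡ-≤ N (+-monoʳ-≤ r b≤N)) (≤-reflexive (m+n∸n≡m r N)))
               (≤-trans (<⇒≤ r<) (binom-step n (suc i)))
  subadd : ∀ u v → u + v ≤ N → ShadowSubadditive (n ∸ suc i) u v
  subadd u v u+v≤N = Invariants.shadow-subadd IH (n ∸ suc i) u v (≤-trans u+v≤N (≤-trans (<⇒≤ N<r+b) r+b≤s))
  regroup : ∀ x y z → x + (y + z) ≡ y + x + z
  regroup = solve-∀
  a+b≡ : a + b ≡ binom (suc n) (suc (suc i)) + e
  a+b≡ = begin-equality
    a + b                 ≡⟨ leading-sum d b ⟩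
    B + (r + b)           ≡⟨ cong (B +_) (sym N+e) ⟩
    B + (N + e)           ≡⟨ regroup B N e ⟩
    N + B + e ∎

absorb : ∀ {s} → Invariants s → ∀ i n r → r < binom n (suc i) → r + binom n i ≤ s →
  r + upper (suc i) r ≤ upper (suc i) (r + binom n i)
absorb IH zero n r _ _ = ≤-reflexive (trans (sym (binom-two-suc r)) (cong (λ t → binom t 2) (+-comm 1 r)))
absorb {s} IH (suc i) n r r< bound = begin
    r + g r                          ≡⟨ +-comm r (g r) ⟩
    g r + r                          ≡⟨ cong (g r +_) (sym (m≥n⇒m⊓n≡n r≤)) ⟩
    g r + (upper (suc i) c ⊓ r)      ≤⟨ Invariants.main IH i r c bound ⟩
    g (r + c) ∎
  where
  open ≤-Reasoning
  g = upper (suc (suc i))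
  c = binom n (suc i)
  r≤ : r ≤ upper (suc i) c
  r≤ = subst (r ≤_) (sym (upper-full i n)) (<⇒≤ r<)

-- Case N + C(n, i) ≤ b: the minimum is bounded by a, and a itself is absorbed.
main-absorb : ∀ {i a b} → (d : Decomposition (suc i) a) → let open Decomposition d in
  binom n (suc i) + binom n i ≤ b → r + upper (suc i) r ≤ upper (suc i) (r + binom n i) → MainIneq i a b
main-absorb {i} {a} {b} d N+c≤b absorbed = begin
    F a + (g b ⊓ a)        ≤⟨ +-monoʳ-≤ (F a) (m⊓n≤n (g b) a) ⟩
    F a + a                ≡⟨ cong₂ _+_ (leading-upper d) m≡ ⟩
    B' + g r + (B + r)     ≡⟨ regroup B' (g r) B r ⟩
    B + B' + (r + g r)     ≤⟨ +-monoʳ-≤ (B + B') absorbed ⟩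
    B + B' + g (r + c)     ≡⟨ sym (upper-rec i (suc n) (r + c) (≤-trans k<n (n≤1+n n)) r+c≤) ⟩
    F (binom (suc n) (suc (suc i)) + (r + c))
                           ≤⟨ upper-mono (suc (suc i)) fits-in ⟩
    F (a + b) ∎
  where
  open ≤-Reasoning
  open Decomposition d
  F = upper (suc (suc i))
  g = upper (suc i)
  N = binom n (suc i)
  c = binom n i
  B = binom n (suc (suc i))
  B' = binom n (suc (suc (suc i)))
  regroup : ∀ B' gr B r → B' + gr + (B + r) ≡ B + B' + (r + gr)
  regroup = solve-∀
  r+c≤ : r + c ≤ binom (suc n) (suc i)
  r+c≤ = subst (r + c ≤_) (+-comm N c) (+-monoˡ-≤ c (<⇒≤ r<))
  regroup' : ∀ N B r c → N + B + (r + c) ≡ B + r + (N + c)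
  regroup' = solve-∀
  fits-in : binom (suc n) (suc (suc i)) + (r + c) ≤ a + b
  fits-in = begin
    N + B + (r + c)        ≡⟨ regroup' N B r c ⟩
    B + r + (N + c)        ≤⟨ +-monoʳ-≤ (B + r) N+c≤b ⟩
    B + r + b              ≡⟨ cong (_+ b) (sym m≡) ⟩
    a + b ∎

-- Case N < b < N + C(n, i), at level i+1 ≥ 2: b = C(n, i+1) + b'' is a representation
-- with the same n, and the theorem for (r, b'') one level down gives it for (a, b).
main-descend : ∀ {s i a b} → Invariants s → (d : Decomposition (suc (suc i)) a) →
  let open Decomposition d in r + b ≤ s →
  binom n (suc (suc i)) < b → b ≤ binom (suc n) (suc (suc i)) → MainIneq (suc i) a b
main-descend {s} {i} {a} {b} IH d r+b≤s N<b b≤ = begin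
    F a + (g b ⊓ a)                    ≡⟨ cong₂ (λ t u → t + (u ⊓ a)) (leading-upper d) g-b ⟩
    B' + g r + ((B + h b'') ⊓ a)       ≡⟨ cong (λ t → B' + g r + ((B + h b'') ⊓ t)) m≡ ⟩
    B' + g r + ((B + h b'') ⊓ (B + r)) ≡⟨ cong (B' + g r +_) (sym (+-distribˡ-⊓ B (h b'') r)) ⟩
    B' + g r + (B + (h b'' ⊓ r))       ≡⟨ regroup B' (g r) B (h b'' ⊓ r) ⟩
    B + B' + (g r + (h b'' ⊓ r))       ≤⟨ +-monoʳ-≤ (B + B') (Invariants.main IH i r b'' r+b''≤s) ⟩
    B + B' + g (r + b'')               ≡⟨ sym (upper-rec (suc i) (suc n) (r + b'') (m≤n⇒m≤1+n k<n) r+b''≤) ⟩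
    F (binom (suc n) (suc (suc (suc i))) + (r + b''))
                                       ≡⟨ cong F (sym a+b≡) ⟩
    F (a + b) ∎
  where
  open ≤-Reasoning
  open Decomposition d
  F = upper (suc (suc (suc i)))
  g = upper (suc (suc i))
  h = upper (suc i)
  N = binom n (suc (suc i))
  c = binom n (suc i)
  B = binom n (suc (suc (suc i)))
  B' = binom n (suc (suc (suc (suc i))))
  b'' = b ∸ N
  N+b'' : N + b'' ≡ b
  N+b'' = m+[n∸m]≡n (<⇒≤ N<b)
  b''≤ : b'' ≤ c
  b''≤ = +-cancelˡ-≤ N _ _ (subst₂ _≤_ (sym N+b'') (+-comm c N) b≤)
  g-b : g b ≡ B + h b''
  g-b = trans (cong g (sym N+b'')) (upper-rec i n b'' (≤-pred (m≤n⇒m≤1+n k<n)) b''≤)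
  r+b''≤s : r + b'' ≤ s
  r+b''≤s = ≤-trans (+-monoʳ-≤ r (subst (b'' ≤_) N+b'' (m≤n+m b'' N))) r+b≤s
  r+b''≤ : r + b'' ≤ binom (suc n) (suc (suc i))
  r+b''≤ = subst (r + b'' ≤_) (+-comm N c) (+-mono-≤ (<⇒≤ r<) b''≤)
  regroup : ∀ B' gr B m → B' + gr + (B + m) ≡ B + B' + (gr + m)
  regroup = solve-∀
  regroup' : ∀ B r N b'' → B + (r + (N + b'')) ≡ N + B + (r + b'')
  regroup' = solve-∀
  a+b≡ : a + b ≡ binom (suc n) (suc (suc (suc i))) + (r + b'')
  a+b≡ = trans (leading-sum d b) (trans (cong (λ t → B + (r + t)) (sym N+b'')) (regroup' B r N b''))

-- Case N < b: either C(n, i) more fits into b and a is absorbed, or (only possible for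
-- i ≥ 1) b is below C(n+1, i+1) and we descend a level.
main-large-b : ∀ {s} i {a b} → Invariants s → (d : Decomposition (suc i) a) →
  let open Decomposition d in r + b ≤ s → binom n (suc i) < b → MainIneq i a b
main-large-b zero {b = b} IH d@(decomposition n r _ _ r<) r+b≤s N<b =
  main-absorb d N+1≤b (absorb IH zero n r r< (≤-trans (+-monoʳ-≤ r (≤-trans (m≤n+m 1 _) N+1≤b)) r+b≤s))
  where
  N+1≤b : binom n 1 + 1 ≤ b
  N+1≤b = subst (_≤ b) (+-comm 1 (binom n 1)) N<b
main-large-b (suc i) {b = b} IH d@(decomposition n r _ _ r<) r+b≤s N<b
  with binom n (suc (suc i)) + binom n (suc i) ≤? b
... | yes N+c≤b = main-absorb d N+c≤b
      (absorb IH (suc i) n r r< (≤-trans (+-monoʳ-≤ r (≤-trans (m≤n+m _ _) N+c≤b)) r+b≤s))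
... | no N+c≰b = main-descend IH d r+b≤s N<b
      (subst (b ≤_) (+-comm (binom n (suc (suc i))) _) (<⇒≤ (≰⇒> N+c≰b)))

main-empty : ∀ i b → MainIneq i 0 b
main-empty i b = ≤-trans (≤-reflexive (cong₂ _+_ (upper-zero (suc (suc i))) (⊓-zeroʳ (upper (suc i) b)))) z≤n

main-at : ∀ {s} → Invariants s → ∀ i a b → a + b ≡ suc s → MainIneq i a b
main-at IH i zero b _ = main-empty i b
main-at IH i (suc a) b sum = by-cases (decompose (suc i) (suc a) (s≤s z≤n))
  where
  by-cases : (d : Decomposition (suc i) (suc a)) → MainIneq i (suc a) b
  by-cases d@(decomposition n r _ _ _) with r + b ≤? binom n (suc i) | b ≤? binom n (suc i)
  ... | yes fits | _ = main-fits IH d (rest-bound d sum) fits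
  ... | no ¬fits | yes b≤N = main-spread IH d (rest-bound d sum) (≰⇒> ¬fits) b≤N
  ... | no _ | no b≰N = main-large-b i IH d (rest-bound d sum) (≰⇒> b≰N)

upper-add-full : ∀ {t} j → (∀ a b → a + b ≤ t → MainIneq j a b) →
  ∀ x q → x + binom q (suc (suc j)) ≤ t →
  upper (suc (suc j)) x + binom q (suc (suc (suc j))) ≤ upper (suc (suc j)) (x + binom q (suc (suc j)))
upper-add-full j main x zero _ =
  ≤-reflexive (trans (+-identityʳ _) (cong (upper (suc (suc j))) (sym (+-identityʳ x))))
upper-add-full {t} j main x (suc q) bound = begin
    F x + (c + c')                      ≡⟨ cong (F x +_) (+-comm c c') ⟩
    F x + (c' + c)                      ≡⟨ sym (+-assoc (F x) c' c) ⟩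
    F x + c' + c                        ≤⟨ +-monoˡ-≤ c (upper-add-full j main x q bound') ⟩
    F (x + c) + c                       ≡⟨ cong (F (x + c) +_) (sym min≡) ⟩
    F (x + c) + (g c'' ⊓ (x + c))       ≤⟨ main (x + c) c'' (≤-trans (≤-reflexive split) bound) ⟩
    F (x + c + c'')                     ≡⟨ cong F split ⟩
    F (x + binom (suc q) (suc (suc j))) ∎
  where
  open ≤-Reasoning
  F = upper (suc (suc j))
  g = upper (suc j)
  c'' = binom q (suc j)
  c = binom q (suc (suc j))
  c' = binom q (suc (suc (suc j)))
  bound' : x + binom q (suc (suc j)) ≤ t
  bound' = ≤-trans (+-monoʳ-≤ x (binom-step q _)) bound
  split : x + c + c'' ≡ x + binom (suc q) (suc (suc j))
  split = trans (+-assoc x c c'') (cong (x +_) (+-comm c c''))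
  min≡ : g c'' ⊓ (x + c) ≡ c
  min≡ = trans (cong (_⊓ (x + c)) (upper-full j q)) (m≤n⇒m⊓n≡m (m≤n+m c x))

upper-superadditive : ∀ {t} → (∀ i a b → a + b ≤ t → MainIneq i a b) →
  ∀ j x y → x + y ≤ t → UpperSuperadditive j x y
upper-superadditive main j x zero _ =
  ≤-reflexive (trans (cong (upper (suc j) x +_) (upper-zero (suc j)))
    (trans (+-identityʳ _) (cong (upper (suc j)) (sym (+-identityʳ x)))))
upper-superadditive main zero x (suc y) _ =
  ≤-trans (m≤m+n _ (x * suc y)) (≤-reflexive (sym (binom-two-add x (suc y))))
upper-superadditive {t} main (suc j) x (suc y) bound = begin
    F x + F (suc y)                     ≡⟨ cong (F x +_) (leading-upper d) ⟩
    F x + (c' + g r)                    ≡⟨ sym (+-assoc (F x) c' (g r)) ⟩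
    F x + c' + g r                      ≤⟨ +-monoˡ-≤ (g r) (upper-add-full j (main j) x n x+c≤) ⟩
    F (x + c) + g r                     ≡⟨ cong (F (x + c) +_) (sym min≡) ⟩
    F (x + c) + (g r ⊓ (x + c))         ≤⟨ main j (x + c) r (≤-trans (≤-reflexive regroup) bound) ⟩
    F (x + c + r)                       ≡⟨ cong F regroup ⟩
    F (x + suc y) ∎
  where
  open ≤-Reasoning
  d = decompose (suc j) (suc y) (s≤s z≤n)
  open Decomposition d
  F = upper (suc (suc j))
  g = upper (suc j)
  c = binom n (suc (suc j))
  c' = binom n (suc (suc (suc j)))
  regroup : x + c + r ≡ x + suc y
  regroup = trans (+-assoc x c r) (cong (x +_) (sym m≡))
  x+c≤ : x + c ≤ t
  x+c≤ = ≤-trans (+-monoʳ-≤ x (subst (c ≤_) (sym m≡) (m≤m+n c r))) bound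
  min≡ : g r ⊓ (x + c) ≡ g r
  min≡ = m≤n⇒m⊓n≡m (≤-trans (upper-mono (suc j) (<⇒≤ r<))
                      (≤-trans (≤-reflexive (upper-full j n)) (m≤n+m c x)))

-- Throughout, a = C(n, k+2) + r with r < N = C(n, k+1), so a_(k+2) = N + r_(k+1).
-- Case r + b ≤ N: subadditivity on (r, b).
shadow-fits : ∀ {s k a b} → Invariants s → (d : Decomposition (suc k) a) →
  let open Decomposition d in r + b ≤ s → r + b ≤ binom n (suc k) → ShadowMaxIneq (suc k) a b
shadow-fits {s} {k} {a} {b} IH d r+b≤s fits = begin
    E (a + b)              ≡⟨ cong E (leading-sum d b) ⟩
    E (B + (r + b))        ≡⟨ shadow-rec (suc k) n (r + b) k<n fits ⟩
    N + G (r + b)          ≤⟨ +-monoʳ-≤ N (Invariants.shadow-subadd IH (suc k) r b r+b≤s) ⟩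
    N + (G r + G b)        ≡⟨ sym (+-assoc N (G r) (G b)) ⟩
    N + G r + G b          ≡⟨ cong (_+ G b) (sym (leading-shadow d)) ⟩
    E a + G b              ≤⟨ +-monoˡ-≤ (G b) (m≤m⊔n (E a) b) ⟩
    (E a ⊔ b) + G b ∎
  where
  open ≤-Reasoning
  open Decomposition d
  E = shadow (suc (suc k))
  G = shadow (suc k)
  N = binom n (suc k)
  B = binom n (suc (suc k))

-- Case b ≤ N < r + b: a + b = C(n+1, k+2) + e with N + e = r + b; balancing N, e
-- to r, b raises the shadow (superadditivity of the upper boundary).
shadow-spread-case : ∀ {s k a b} → Invariants s → (d : Decomposition (suc k) a) →
  let open Decomposition d in r + b ≤ s → binom n (suc k) < r + b → b ≤ binom n (suc k) →
  ShadowMaxIneq (suc k) a b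
shadow-spread-case {s} {k} {a} {b} IH d r+b≤s N<r+b b≤N = begin
    E (a + b)              ≡⟨ cong E a+b≡ ⟩
    E (binom (suc n) (suc (suc k)) + e)
                           ≡⟨ shadow-rec (suc k) (suc n) e (≤-trans k<n (n≤1+n n)) e≤ ⟩
    binom n k + N + G e    ≡⟨ cong (λ t → t + N + G e) (sym (shadow-full k n (≤-pred (m≤n⇒m≤1+n k<n)))) ⟩
    G N + N + G e          ≡⟨ regroup (G N) N (G e) ⟩
    N + (G N + G e)        ≤⟨ +-monoʳ-≤ N (shadow-spread k n k<n superadd (<⇒≤ r<) b≤N N+e) ⟩
    N + (G r + G b)        ≡⟨ sym (+-assoc N (G r) (G b)) ⟩
    N + G r + G b          ≡⟨ cong (_+ G b) (sym (leading-shadow d)) ⟩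
    E a + G b              ≤⟨ +-monoˡ-≤ (G b) (m≤m⊔n (E a) b) ⟩
    (E a ⊔ b) + G b ∎
  where
  open ≤-Reasoning
  open Decomposition d
  E = shadow (suc (suc k))
  G = shadow (suc k)
  N = binom n (suc k)
  B = binom n (suc (suc k))
  regroup : ∀ x y z → x + y + z ≡ y + (x + z)
  regroup = solve-∀
  e = r + b ∸ N
  N+e : N + e ≡ r + b
  N+e = m+[n∸m]≡n (<⇒≤ N<r+b)
  e≤ : e ≤ binom (suc n) (suc k)
  e≤ = ≤-trans (≤-trans (∸-monoˡ-≤ N (+-monoʳ-≤ r b≤N)) (≤-reflexive (m+n∸n≡m r N)))
               (≤-trans (<⇒≤ r<) (binom-step n (suc k)))
  superadd : ∀ j u v → u + v ≤ N → UpperSuperadditive j u v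
  superadd j u v u+v≤N = Invariants.upper-superadd IH j u v (≤-trans u+v≤N (≤-trans (<⇒≤ N<r+b) r+b≤s))
  a+b≡ : a + b ≡ binom (suc n) (suc (suc k)) + e
  a+b≡ = begin-equality
    a + b                 ≡⟨ leading-sum d b ⟩
    B + (r + b)           ≡⟨ cong (B +_) (sym N+e) ⟩
    B + (N + e)           ≡⟨ sym (+-assoc B N e) ⟩
    B + N + e             ≡⟨ cong (_+ e) (+-comm B N) ⟩
    N + B + e ∎

-- Case N < b ≤ C(n+1, k+1): b = N + b'' with b'' ≤ C(n, k), and the inequality for
-- (r, b'') one level down gives it for (a, b).
shadow-descend : ∀ {s k a b} → Invariants s → (d : Decomposition (suc k) a) →
  let open Decomposition d in r + b ≤ s → binom n (suc k) < b → b ≤ binom (suc n) (suc k) →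
  ShadowMaxIneq (suc k) a b
shadow-descend {s} {k} {a} {b} IH d r+b≤s N<b b≤ = begin
    E (a + b)                         ≡⟨ cong E a+b≡ ⟩
    E (binom (suc n) (suc (suc k)) + (r + b''))
                                      ≡⟨ shadow-rec (suc k) (suc n) (r + b'') (≤-trans k<n (n≤1+n n)) r+b''≤ ⟩
    c + N + G (r + b'')               ≤⟨ +-monoʳ-≤ (c + N) (Invariants.shadow-max IH k r b'' r+b''≤s) ⟩
    c + N + ((G r ⊔ b'') + H b'')     ≡⟨ regroup c N (G r ⊔ b'') (H b'') ⟩
    (N + (G r ⊔ b'')) + (c + H b'')   ≡⟨ cong (_+ (c + H b'')) (+-distribˡ-⊔ N (G r) b'') ⟩
    ((N + G r) ⊔ (N + b'')) + (c + H b'')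
                                      ≡⟨ cong₂ _+_ (cong₂ _⊔_ (sym (leading-shadow d)) N+b'') (sym G-b) ⟩
    (E a ⊔ b) + G b ∎
  where
  open ≤-Reasoning
  open Decomposition d
  E = shadow (suc (suc k))
  G = shadow (suc k)
  H = shadow k
  N = binom n (suc k)
  c = binom n k
  B = binom n (suc (suc k))
  b'' = b ∸ N
  N+b'' : N + b'' ≡ b
  N+b'' = m+[n∸m]≡n (<⇒≤ N<b)
  b''≤ : b'' ≤ c
  b''≤ = +-cancelˡ-≤ N _ _ (subst₂ _≤_ (sym N+b'') (+-comm c N) b≤)
  G-b : G b ≡ c + H b''
  G-b = trans (cong G (sym N+b'')) (shadow-rec k n b'' (≤-pred (m≤n⇒m≤1+n k<n)) b''≤)
  r+b''≤s : r + b'' ≤ s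
  r+b''≤s = ≤-trans (+-monoʳ-≤ r (subst (b'' ≤_) N+b'' (m≤n+m b'' N))) r+b≤s
  r+b''≤ : r + b'' ≤ binom (suc n) (suc k)
  r+b''≤ = subst (r + b'' ≤_) (+-comm N c) (+-mono-≤ (<⇒≤ r<) b''≤)
  regroup : ∀ c N m h → c + N + (m + h) ≡ (N + m) + (c + h)
  regroup = solve-∀
  regroup' : ∀ B r N b'' → B + (r + (N + b'')) ≡ N + B + (r + b'')
  regroup' = solve-∀
  a+b≡ : a + b ≡ binom (suc n) (suc (suc k)) + (r + b'')
  a+b≡ = trans (leading-sum d b) (trans (cong (λ t → B + (r + t)) (sym N+b'')) (regroup' B r N b''))

shadow-max-empty : ∀ k b → ShadowMaxIneq k 0 b → shadow (suc k) b ≤ b + shadow k b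
shadow-max-empty k b ineq = subst (λ t → shadow (suc k) b ≤ (t ⊔ b) + shadow k b) (shadow-zero (suc k)) ineq

-- Case b > C(n+1, k+1): then b = C(p, k+1) + b'' with p > n, and a + b lies below
-- C(p+1, k+2) + b''; the bound b_(k+1) ≤ b + b_(k) concludes.
shadow-large-b : ∀ {s k a b} → Invariants s → (d : Decomposition (suc k) a) →
  let open Decomposition d in r + b ≤ s → binom (suc n) (suc k) < b → ShadowMaxIneq (suc k) a b
shadow-large-b {s} {k} {a} {b} IH d r+b≤s big with decompose k b (≤-trans (s≤s z≤n) big)
... | decomposition p b'' k<p b≡ b''< = begin
    E (a + b)                        ≤⟨ shadow-mono (suc (suc k)) a+b≤ ⟩
    E (binom (suc p) (suc (suc k)) + b'')
                                     ≡⟨ shadow-rec (suc k) (suc p) b'' (s≤s k<p) b''≤ ⟩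
    binom p k + P + G b''            ≤⟨ +-monoʳ-≤ (binom p k + P)
                                          (shadow-max-empty k b'' (Invariants.shadow-max IH k 0 b'' b''≤s)) ⟩
    binom p k + P + (b'' + H b'')    ≡⟨ regroup (binom p k) P b'' (H b'') ⟩
    (P + b'') + (binom p k + H b'')  ≡⟨ cong₂ _+_ (sym b≡) (sym G-b) ⟩
    b + G b                          ≤⟨ +-monoˡ-≤ (G b) (m≤n⊔m (E a) b) ⟩
    (E a ⊔ b) + G b ∎
  where
  open ≤-Reasoning
  open Decomposition d
  E = shadow (suc (suc k))
  G = shadow (suc k)
  H = shadow k
  P = binom p (suc k)
  regroup : ∀ x y z w → x + y + (z + w) ≡ (y + z) + (x + w)
  regroup = solve-∀
  G-b : G b ≡ binom p k + H b''
  G-b = trans (cong G b≡) (shadow-rec k p b'' k<p (<⇒≤ b''<))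
  b''≤s : 0 + b'' ≤ s
  b''≤s = ≤-trans (subst (b'' ≤_) (sym b≡) (m≤n+m b'' _)) (≤-trans (m≤n+m b r) r+b≤s)
  b''≤ : b'' ≤ binom (suc p) (suc k)
  b''≤ = ≤-trans (<⇒≤ b''<) (m≤m+n (binom p k) _)
  n<p : suc n ≤ p
  n<p with suc n ≤? p
  ... | yes n<p = n<p
  ... | no n≮p = ⊥-elim (<⇒≱ big (≤-trans (<⇒≤ b<) (binom-mono (suc k) (s≤s (≤-pred (≰⇒> n≮p))))))
    where
    b< : b < binom (suc p) (suc k)
    b< = subst (b <_) (+-comm P (binom p k)) (subst (_< P + binom p k) (sym b≡) (+-monoʳ-< P b''<))
  a< : a < binom (suc n) (suc (suc k))
  a< = subst (a <_) (+-comm (binom n (suc (suc k))) _)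
         (subst (_< binom n (suc (suc k)) + binom n (suc k)) (sym m≡) (+-monoʳ-< _ r<))
  a+b≤ : a + b ≤ binom (suc p) (suc (suc k)) + b''
  a+b≤ = begin
    a + b                                  ≡⟨ cong (a +_) b≡ ⟩
    a + (P + b'')                          ≤⟨ +-monoˡ-≤ _ (≤-trans (<⇒≤ a<) (binom-mono (suc (suc k)) n<p)) ⟩
    binom p (suc (suc k)) + (P + b'')      ≡⟨ sym (+-assoc (binom p (suc (suc k))) P b'') ⟩
    binom p (suc (suc k)) + P + b''        ≡⟨ cong (_+ b'') (+-comm (binom p (suc (suc k))) P) ⟩
    binom (suc p) (suc (suc k)) + b'' ∎

shadow-max-step : ∀ {s} → Invariants s → ∀ k a b → 1 ≤ a → a + b ≡ suc s → ShadowMaxIneq k a b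
shadow-max-step IH zero a b 1≤a _ = begin
    shadow 1 (a + b)         ≡⟨ shadow-level-one (a + b) (≤-trans 1≤a (m≤m+n a b)) ⟩
    1                        ≤⟨ m≤m⊔n 1 b ⟩
    1 ⊔ b                    ≡⟨ cong (_⊔ b) (sym (shadow-level-one a 1≤a)) ⟩
    shadow 1 a ⊔ b           ≡⟨ sym (+-identityʳ _) ⟩
    (shadow 1 a ⊔ b) + 0 ∎
  where open ≤-Reasoning
shadow-max-step IH (suc k) a b 1≤a sum = by-cases (decompose (suc k) a 1≤a)
  where
  by-cases : (d : Decomposition (suc k) a) → ShadowMaxIneq (suc k) a b
  by-cases d@(decomposition n r _ _ _)
    with r + b ≤? binom n (suc k) | b ≤? binom n (suc k) | b ≤? binom (suc n) (suc k)
  ... | yes fits | _ | _ = shadow-fits IH d (rest-bound d sum) fits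
  ... | no ¬fits | yes b≤N | _ = shadow-spread-case IH d (rest-bound d sum) (≰⇒> ¬fits) b≤N
  ... | no _ | no b≰N | yes b≤ = shadow-descend IH d (rest-bound d sum) (≰⇒> b≰N) b≤
  ... | no _ | no _ | no big = shadow-large-b IH d (rest-bound d sum) (≰⇒> big)

-- Reading 1 + r at level k+1 for r ≤ k+1: the leading term is C(k+1, k+1) = 1.
shadow-peel-one : ∀ k r → r ≤ suc k → shadow (suc k) (suc r) ≡ suc k + shadow k r
shadow-peel-one k r r≤ = begin
    shadow (suc k) (suc r)                       ≡⟨ cong (λ t → shadow (suc k) (t + r)) (sym (binom-diag (suc k))) ⟩
    shadow (suc k) (binom (suc k) (suc k) + r)   ≡⟨ shadow-rec k (suc k) r ≤-refl (subst (r ≤_) (sym (binom-sub-diag k)) r≤) ⟩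
    binom (suc k) k + shadow k r                 ≡⟨ cong (_+ shadow k r) (binom-sub-diag k) ⟩
    suc k + shadow k r ∎
  where open ≡-Reasoning

shadow-small : ∀ k b → b ≤ k → suc k + shadow k b ≤ suc b + shadow k (suc b)
shadow-small zero zero _ = ≤-refl
shadow-small (suc k) zero _ = ≤-reflexive (begin-equality
    suc (suc k) + shadow (suc k) 0   ≡⟨ cong (suc (suc k) +_) (shadow-zero (suc k)) ⟩
    suc (suc k) + 0                  ≡⟨ +-identityʳ _ ⟩
    suc (suc k)                      ≡⟨ cong suc (sym (shadow-one k)) ⟩
    suc (shadow (suc k) 1) ∎)
  where open ≤-Reasoning
shadow-small (suc k) (suc b) (s≤s b≤k) = begin
    suc (suc k) + shadow (suc k) (suc b)       ≡⟨ cong (suc (suc k) +_) (shadow-peel-one k b (m≤n⇒m≤1+n b≤k)) ⟩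
    suc (suc k) + (suc k + shadow k b)         ≡⟨ regroup k (shadow k b) ⟩
    suc k + suc (suc k + shadow k b)           ≤⟨ +-monoʳ-≤ (suc k) (s≤s (shadow-small k b b≤k)) ⟩
    suc k + suc (suc b + shadow k (suc b))     ≡⟨ regroup' k b (shadow k (suc b)) ⟩
    suc (suc b) + (suc k + shadow k (suc b))   ≡⟨ cong (suc (suc b) +_) (sym (shadow-peel-one k (suc b) (s≤s b≤k))) ⟩
    suc (suc b) + shadow (suc k) (suc (suc b)) ∎
  where
  open ≤-Reasoning
  regroup : ∀ k x → suc (suc k) + (suc k + x) ≡ suc k + suc (suc k + x)
  regroup = solve-∀
  regroup' : ∀ k b y → suc k + suc (suc b + y) ≡ suc (suc b) + (suc k + y)
  regroup' = solve-∀

-- The case a = 0 follows from the case a = 1 for the same sum, using 1_(k+1) = k+1.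
shadow-max-from-one : ∀ k b → ShadowMaxIneq k 1 b → ShadowMaxIneq k 0 (suc b)
shadow-max-from-one k b ineq =
  subst (λ t → shadow (suc k) (suc b) ≤ (t ⊔ suc b) + shadow k (suc b)) (sym (shadow-zero (suc k))) (begin
    shadow (suc k) (suc b)                ≤⟨ ineq ⟩
    (shadow (suc k) 1 ⊔ b) + shadow k b   ≡⟨ cong (λ t → (t ⊔ b) + shadow k b) (shadow-one k) ⟩
    (suc k ⊔ b) + shadow k b              ≤⟨ max-bound ⟩
    suc b + shadow k (suc b) ∎)
  where
  open ≤-Reasoning
  max-bound : (suc k ⊔ b) + shadow k b ≤ suc b + shadow k (suc b)
  max-bound with suc k ≤? b
  ... | yes k<b = begin
    (suc k ⊔ b) + shadow k b   ≡⟨ cong (_+ shadow k b) (m≤n⇒m⊔n≡n k<b) ⟩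
    b + shadow k b             ≤⟨ +-mono-≤ (n≤1+n b) (shadow-grows k b) ⟩
    suc b + shadow k (suc b) ∎
  ... | no k≮b = begin
    (suc k ⊔ b) + shadow k b   ≡⟨ cong (_+ shadow k b) (m≥n⇒m⊔n≡m (<⇒≤ (≰⇒> k≮b))) ⟩
    suc k + shadow k b         ≤⟨ shadow-small k b (≤-pred (≰⇒> k≮b)) ⟩
    suc b + shadow k (suc b) ∎

shadow-max-at : ∀ {s} → Invariants s → ∀ k a b → a + b ≡ suc s → ShadowMaxIneq k a b
shadow-max-at IH k zero (suc b) sum = shadow-max-from-one k b (shadow-max-step IH k 1 b ≤-refl sum)
shadow-max-at IH k (suc a) b sum = shadow-max-step IH k (suc a) b (s≤s z≤n) sum

shadow-add-full : ∀ {t} k → (∀ a b → a + b ≤ t → ShadowMaxIneq (suc k) a b) →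
  ∀ x q → 1 ≤ x → x + binom q (suc (suc k)) ≤ t →
  shadow (suc (suc k)) (x + binom q (suc (suc k))) ≤ shadow (suc (suc k)) x + binom q (suc k)
shadow-add-full k max x zero _ _ =
  ≤-reflexive (trans (cong (shadow (suc (suc k))) (+-identityʳ x)) (sym (+-identityʳ _)))
shadow-add-full {t} k max x (suc q) 1≤x bound = begin
    E (x + binom (suc q) (suc (suc k)))   ≡⟨ cong E split ⟩
    E (x + c + c')                        ≤⟨ max (x + c) c' (≤-trans (≤-reflexive (sym split)) bound) ⟩
    (E (x + c) ⊔ c') + G c'               ≡⟨ cong (_+ G c') (m≥n⇒m⊔n≡m c'≤) ⟩
    E (x + c) + G c'                      ≤⟨ +-mono-≤ (shadow-add-full k max x q 1≤x bound') G-c' ⟩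
    E x + c' + binom q k                  ≡⟨ +-assoc (E x) c' _ ⟩
    E x + (c' + binom q k)                ≡⟨ cong (E x +_) (+-comm c' _) ⟩
    E x + binom (suc q) (suc k) ∎
  where
  open ≤-Reasoning
  E = shadow (suc (suc k))
  E-mono = shadow-mono (suc (suc k))
  G = shadow (suc k)
  c = binom q (suc (suc k))
  c' = binom q (suc k)
  bound' : x + binom q (suc (suc k)) ≤ t
  bound' = ≤-trans (+-monoʳ-≤ x (binom-step q _)) bound
  split : x + binom (suc q) (suc (suc k)) ≡ x + c + c'
  split = trans (cong (x +_) (+-comm c' c)) (sym (+-assoc x c c'))
  -- c' is dominated by the shadow of x + c: it is the shadow of c when c ≠ 0, and at most 1 otherwise
  c'≤ : c' ≤ E (x + c)
  c'≤ with suc (suc k) ≤? q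
  ... | yes k+2≤q = ≤-trans (≤-reflexive (sym (shadow-full (suc k) q k+2≤q))) (E-mono (m≤n+m c x))
  ... | no k+2≰q = ≤-trans (binom-at-most-one (≤-pred (≰⇒> k+2≰q)))
      (≤-trans (≤-trans (s≤s z≤n) (≤-reflexive (sym (shadow-one (suc k))))) (E-mono (≤-trans 1≤x (m≤m+n x c))))
  G-c' : G c' ≤ binom q k
  G-c' with suc k ≤? q
  ... | yes k<q = ≤-reflexive (shadow-full k q k<q)
  ... | no k≮q = ≤-trans (≤-reflexive (trans (cong G (binom-vanish (≰⇒> k≮q))) (shadow-zero (suc k)))) z≤n

shadow-subadditive : ∀ {t} → (∀ k a b → a + b ≤ t → ShadowMaxIneq k a b) →
  ∀ k x y → x + y ≤ t → ShadowSubadditive k x y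
shadow-subadditive max zero x y _ = z≤n
shadow-subadditive max (suc k) zero y _ = ≤-reflexive (sym (cong (_+ shadow (suc k) y) (shadow-zero (suc k))))
shadow-subadditive max (suc zero) (suc x) y _ =
  ≤-trans (≤-reflexive (shadow-level-one (suc x + y) (s≤s z≤n))) (m≤m+n _ (shadow 1 y))
shadow-subadditive max (suc (suc k)) (suc x) zero _ =
  ≤-reflexive (trans (cong (shadow (suc (suc k))) (+-identityʳ (suc x)))
    (sym (trans (cong (shadow (suc (suc k)) (suc x) +_) (shadow-zero (suc (suc k)))) (+-identityʳ _))))
shadow-subadditive {t} max (suc (suc k)) (suc x) (suc y) bound = begin
    E (suc x + suc y)                  ≡⟨ cong E regroup ⟩
    E ((suc x + c) + r)                ≤⟨ max (suc k) (suc x + c) r (≤-trans (≤-reflexive (sym regroup)) bound) ⟩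
    (E (suc x + c) ⊔ r) + G r          ≡⟨ cong (_+ G r) (m≥n⇒m⊔n≡m r≤) ⟩
    E (suc x + c) + G r                ≤⟨ +-monoˡ-≤ (G r) (shadow-add-full k (max (suc k)) (suc x) n z<s x+c≤) ⟩
    E (suc x) + c' + G r               ≡⟨ +-assoc (E (suc x)) c' (G r) ⟩
    E (suc x) + (c' + G r)             ≡⟨ cong (E (suc x) +_) (sym (leading-shadow d)) ⟩
    E (suc x) + E (suc y) ∎
  where
  open ≤-Reasoning
  d = decompose (suc k) (suc y) (s≤s z≤n)
  open Decomposition d
  E = shadow (suc (suc k))
  G = shadow (suc k)
  c = binom n (suc (suc k))
  c' = binom n (suc k)
  regroup : suc x + suc y ≡ suc x + c + r
  regroup = trans (cong (suc x +_) m≡) (sym (+-assoc (suc x) c r))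
  x+c≤ : suc x + c ≤ t
  x+c≤ = ≤-trans (+-monoʳ-≤ (suc x) (subst (c ≤_) (sym m≡) (m≤m+n c r))) bound
  r≤ : r ≤ E (suc x + c)
  r≤ = ≤-trans (<⇒≤ r<)
         (≤-trans (≤-reflexive (sym (shadow-full (suc k) n k<n))) (shadow-mono (suc (suc k)) (m≤n+m c (suc x))))

-- Strong induction on the sum: the invariants at s + 1 are assembled from those at s
-- in the order main → superadditivity, shadow inequality → subadditivity.
invariants : ∀ s → Invariants s
invariants zero = record
  { main = main
  ; upper-superadd = upper-superadditive main
  ; shadow-max = max
  ; shadow-subadd = shadow-subadditive max
  }
  where
  main : ∀ i a b → a + b ≤ 0 → MainIneq i a b
  main i zero zero _ = main-empty i 0
  max : ∀ k a b → a + b ≤ 0 → ShadowMaxIneq k a b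
  max k zero zero _ = ≤-trans (≤-reflexive (shadow-zero (suc k))) z≤n
invariants (suc s) = record
  { main = main
  ; upper-superadd = upper-superadditive main
  ; shadow-max = max
  ; shadow-subadd = shadow-subadditive max
  }
  where
  IH = invariants s
  extend : {P : ℕ → ℕ → Set} → (∀ a b → a + b ≤ s → P a b) → (∀ a b → a + b ≡ suc s → P a b) →
    ∀ a b → a + b ≤ suc s → P a b
  extend below at a b a+b≤ with m≤n⇒m<n∨m≡n a+b≤
  ... | inj₁ a+b<s+1 = below a b (≤-pred a+b<s+1)
  ... | inj₂ a+b≡s+1 = at a b a+b≡s+1
  main : ∀ i a b → a + b ≤ suc s → MainIneq i a b
  main i = extend (Invariants.main IH i) (main-at IH i)
  max : ∀ k a b → a + b ≤ suc s → ShadowMaxIneq k a b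
  max k = extend (Invariants.shadow-max IH k) (shadow-max-at IH k)

theorem : ∀ i a b → MainIneq i a b
theorem i a b = Invariants.main (invariants (a + b)) i a b ≤-refl

rep-level : ∀ {j B m b} → RepFrom j B m b → 1 ≤ j × j < B
rep-level (last n<B j≤n 1≤j) = 1≤j , ≤-<-trans j≤n n<B
rep-level (step n<B rep) = s≤s z≤n , ≤-<-trans (proj₂ (rep-level rep)) n<B

rep-bound : ∀ {j B m b} → RepFrom j B m b → m ≤ binom B j
rep-bound {j} (last {n = n} n<B _ _) = subst (_≤ binom _ j) (sym (C≡binom n j)) (binom-mono j (<⇒≤ n<B))
rep-bound {suc j} {B} (step {n = n} {m = m} n<B rep) = begin
    n C suc j + m          ≡⟨ cong (_+ m) (C≡binom n (suc j)) ⟩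
    binom n (suc j) + m    ≤⟨ +-monoʳ-≤ (binom n (suc j)) (rep-bound rep) ⟩
    binom n (suc j) + binom n j
                           ≡⟨ +-comm (binom n (suc j)) _ ⟩
    binom (suc n) (suc j)  ≤⟨ binom-mono (suc j) n<B ⟩
    binom B (suc j) ∎
  where open ≤-Reasoning

rep-upper : ∀ {j B m b} → RepFrom j B m b → b ≡ upper j m
rep-upper (last {j} {n = n} _ j≤n 1≤j) = begin
    n C suc j                ≡⟨ C≡binom n (suc j) ⟩
    binom n (suc j)          ≡⟨ sym (Upper.value-full j n 1≤j j≤n) ⟩
    upper j (binom n j)      ≡⟨ cong (upper j) (sym (C≡binom n j)) ⟩
    upper j (n C j) ∎
  where open ≡-Reasoning
rep-upper (step {n = n} {m = m} {b = b} _ rep) with rep-level rep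
... | s≤s {n = j} _ , j<n = begin
    n C suc (suc (suc j)) + b             ≡⟨ cong₂ _+_ (C≡binom n (suc (suc (suc j)))) (rep-upper rep) ⟩
    binom n (suc (suc (suc j))) + upper (suc j) m
                                          ≡⟨ sym (upper-rec j n m j<n (rep-bound rep)) ⟩
    upper (suc (suc j)) (binom n (suc (suc j)) + m)
                                          ≡⟨ cong (λ t → upper (suc (suc j)) (t + m)) (sym (C≡binom n (suc (suc j)))) ⟩
    upper (suc (suc j)) (n C suc (suc j) + m) ∎
  where open ≡-Reasoning

lemma1 : ∀ (m₁ m₂ i : ℕ) → 1 ≤ m₁ → 1 ≤ m₂ → 2 ≤ i →
    ∀ (s u v : ℕ) →
    UpperBoundary i (m₁ + m₂) s →
    UpperBoundary i m₁ u →
    UpperBoundary (i ∸ 1) m₂ v →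
    s ≥ u + (v ⊓ m₁)
lemma1 m₁ m₂ (suc (suc i)) _ _ _ s u v (_ , rep-s) (_ , rep-u) (_ , rep-v) = begin
    u + (v ⊓ m₁)                                       ≡⟨ cong₂ (λ x y → x + (y ⊓ m₁)) (rep-upper rep-u) (rep-upper rep-v) ⟩
    upper (suc (suc i)) m₁ + (upper (suc i) m₂ ⊓ m₁)   ≤⟨ theorem i m₁ m₂ ⟩
    upper (suc (suc i)) (m₁ + m₂)                      ≡⟨ sym (rep-upper rep-s) ⟩
    s ∎
  where open ≤-Reasoning
lemma1 _ _ (suc zero) _ _ (s≤s ()) _ _ _ _ _ _
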